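{- Let $\mathsf{r}$ be a resource variable of a concurrent program (setting in the context), let $C$ be a constant and let the safety property be $\psi\equiv \mathsf{r}\le C$. Let $t_1,t_2,t_3$ be transitions whose operations are the assignments $t_1:\mathsf{r}:=\mathsf{r}+c_1$, $t_2:\mathsf{r}:=\mathsf{r}*2$, $t_3:\mathsf{r}:=\mathsf{r}-c_2$, where $c_1,c_2>0$. Then for every program point $\ell$, $\langle \ell,\mathit{true},t_1\uparrow t_2,\psi\rangle\wedge\langle \ell,\mathit{true},t_1\uparrow t_3,\psi\rangle\wedge\langle \ell,\mathit{true},t_2\uparrow t_3,\psi\rangle$.
   Context: A concurrent program consists of finitely many processes with pairwise disjoint finite sets of transitions (acyclic control flow), $\mathcal{T}$ being the set of all transitions. A state $s$ has a global program point $\mathtt{pc}(s)$ (tuple of local program counters) and a constraint over program variables; a transition of process $P_i$ is schedulable at $s$ if $P_i$'s program counter in $s$ is the transition's source location, and enabled if additionally its guard holds. $s_0$ is the initial state; an execution trace is a sequence of transitions leading from $s_0$ to a state with no schedulable transition; a trace $\rho$ satisfies $\psi$ ($\rho\models\psi$) if all its states satisfy $\psi$. $t_1$ can de-schedule $t_2$ iff there is a state where both are schedulable but $t_2$ is not schedulable after executing $t_1$. Resource usage setting: $\mathsf{r}$ is a shared variable, initially $0$; each process may only increment $\mathsf{r}$ by a positive constant, decrement it by a positive constant, or double it; $\mathsf{r}$ does not occur in the guard of any transition. Trace coverage: $\rho_1\sqsupseteq_\psi\rho_2$ iff $\rho_1\models\psi$ implies $\rho_2\models\psi$. Semi-commutativity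 after a state: given a derivation $s_0\stackrel{\theta}{\Longrightarrow}s$ and $t,t'\in\mathcal{T}$ which cannot de-schedule each other, $t$ semi-commutes with $t'$ after $s$ wrt $\sqsupseteq_\psi$ iff for all $w_1,w_2\in\mathcal{T}^*$ such that $\theta w_1 t t' w_2$ and $\theta w_1 t' t w_2$ are execution traces, $\theta w_1 t t' w_2\sqsupseteq_\psi\theta w_1 t' t w_2$. Notation $\langle\ell,\varphi,t\uparrow t',\psi\rangle$ ($t$ semi-commutes with $t'$ after program point $\ell$ wrt $\sqsupseteq_\psi$ and $\varphi$): for every state $s$ at program point $\ell$ reachable from $s_0$ with $s\models\varphi$, $t$ semi-commutes with $t'$ after $s$ wrt $\sqsupseteq_\psi$. -}

module Defs where

open import Data.Nat as ℕ using (ℕ; zero; suc)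
open import Data.Integer as ℤ using (ℤ; +_)
open import Data.Fin using (Fin; _≟_)
open import Data.List using (List; []; _∷_; _++_)
open import Data.List.Relation.Unary.All using (All)
open import Data.Product using (Σ; ∃; _×_; _,_)
open import Relation.Nullary using (¬_; does)
open import Relation.Binary.PropositionalEquality using (_≡_)
open import Data.Bool using (if_then_else_)
open import Data.Unit using (⊤)

data ROp : Set where
  keep : ROp
  inc  : ℕ → ROp
  dec  : ℕ → ROp
  dbl  : ROp

ValidROp : ROp → Set
ValidROp keep    = ⊤
ValidROp (inc c) = 0 ℕ.< c
ValidROp (dec c) = 0 ℕ.< c
ValidROp dbl     = ⊤

applyR : ROp → ℤ → ℤ
applyR keep    r = r
applyR (inc c) r = r ℤ.+ + c
applyR (dec c) r = r ℤ.- + c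
applyR dbl     r = r ℤ.* + 2

-- Concurrent programs in the resource-usage setting.
--   * nproc processes, ntrans transitions in total; each transition
--     belongs to exactly one process (so per-process sets are disjoint
--     and finite);
--   * local program counters are natural numbers and every transition
--     goes from a smaller to a strictly larger location (acyclic
--     control flow);
--   * Data is the store of all program variables other than r.  Guards
--     are predicates on Data only (r does not occur in guards), and the
--     effect of a transition is an ROp on r together with an update of
--     the other variables that does not read r.

record Program : Set₁ where
  field
    nproc  : ℕ
    ntrans : ℕ
    Data   : Set
    proc   : Fin ntrans → Fin nproc
    src    : Fin ntrans → ℕ
    tgt    : Fin ntrans → ℕ
    acyclic : ∀ t → src t ℕ.< tgt t
    guard  : Fin ntrans → Data → Set
    rop    : Fin ntrans → ROp
    rop-valid : ∀ t → ValidROp (rop t)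
    dop    : Fin ntrans → Data → Data
    initPc : Fin nproc → ℕ
    initData : Data

module _ (P : Program) where
  open Program P

  Trans : Set
  Trans = Fin ntrans

  ProgPoint : Set
  ProgPoint = Fin nproc → ℕ

  record State : Set where
    constructor ⟨_,_,_⟩
    field
      pc  : ProgPoint
      res : ℤ
      dat : Data
  open State public

  s₀ : State
  s₀ = ⟨ initPc , + 0 , initData ⟩

  Schedulable : Trans → State → Set
  Schedulable t s = pc s (proc t) ≡ src t

  Enabled : Trans → State → Set
  Enabled t s = Schedulable t s × guard t (dat s)

  step : Trans → State → State
  step t s = ⟨ (λ j → if does (j ≟ proc t) then tgt t else pc s j)
             , applyR (rop t) (res s)
             , dop t (dat s) ⟩

  data Run : State → List Trans → State → Set where
    done : ∀ {s} → Run s [] s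
    next : ∀ {s t ts s'} → Enabled t s → Run (step t s) ts s' →
           Run s (t ∷ ts) s'

  ExecTrace : List Trans → Set
  ExecTrace ρ = ∃ λ s → Run s₀ ρ s × (∀ t → ¬ Schedulable t s)

  statesFrom : State → List Trans → List State
  statesFrom s []       = s ∷ []
  statesFrom s (t ∷ ts) = s ∷ statesFrom (step t s) ts

  _⊨_ : List Trans → (State → Set) → Set
  ρ ⊨ ψ = All ψ (statesFrom s₀ ρ)

  Covers : (State → Set) → List Trans → List Trans → Set
  Covers ψ ρ₁ ρ₂ = ρ₁ ⊨ ψ → ρ₂ ⊨ ψ

  CanDeschedule : Trans → Trans → Set
  CanDeschedule t₁ t₂ =
    ∃ λ s → Schedulable t₁ s × Schedulable t₂ s × ¬ Schedulable t₂ (step t₁ s)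

  -- t semi-commutes with t' after (the derivation θ of) s wrt ⊒_ψ
  -- (the notion is only used for t, t' that cannot de-schedule each other)
  SemiCommAfter : List Trans → Trans → Trans → (State → Set) → Set
  SemiCommAfter θ t t' ψ =
    ∀ w₁ w₂ →
    ExecTrace (θ ++ w₁ ++ t ∷ t' ∷ w₂) →
    ExecTrace (θ ++ w₁ ++ t' ∷ t ∷ w₂) →
    Covers ψ (θ ++ w₁ ++ t ∷ t' ∷ w₂) (θ ++ w₁ ++ t' ∷ t ∷ w₂)

  SemiCommAt : ProgPoint → (State → Set) → Trans → Trans → (State → Set) → Set
  SemiCommAt ℓ φ t t' ψ =
    ∀ θ s → Run s₀ θ s → (∀ i → pc s i ≡ ℓ i) → φ s → SemiCommAfter θ t t' ψ

  OnlyAssignsR : Trans → ROp → Set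
  OnlyAssignsR t o = rop t ≡ o × (∀ d → dop t d ≡ d)

-- Every resource operation is monotone, and r does not occur in guards, so the
-- safety of a trace depends only on its sequence of values of r. Swapping
-- adjacent t t' into t' t keeps the prefix, gives an intermediate value that is
-- safe whenever the original ones are, and ends in a value of r no larger than
-- before; by monotonicity the whole suffix then stays below C as well. For the
-- three pairs this comes down to r − c ≤ r, r * 2 ≤ (r + c) * 2,
-- r * 2 + c ≤ (r + c) * 2 and (r − c) * 2 ≤ r * 2 − c, all true for c ≥ 0.
module Submission where

open import Defs
open import Data.Nat using (ℕ; _<_)
open import Data.Integer using (ℤ; _≤_; +_; -_; _+_; _-_; _*_)
open import Data.Integer.Properties
  using (≤-trans; ≤-reflexive; +-monoˡ-≤; *-monoʳ-≤-nonNeg; i≤i+j; i≤j⇒i-k≤j; module ≤-Reasoning)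
open import Data.Integer.Tactic.RingSolver using (solve-∀)
open import Data.List using ([]; _∷_; _++_)
open import Data.List.Relation.Unary.All using (All; []; _∷_)
open import Data.Product using (_×_; _,_)
open import Data.Unit using (⊤)
open import Relation.Nullary using (¬_)
open import Relation.Binary.PropositionalEquality using (_≡_; sym; subst₂)

applyR-mono-≤ : ∀ o {x y} → x ≤ y → applyR o x ≤ applyR o y
applyR-mono-≤ keep    x≤y = x≤y
applyR-mono-≤ (inc c) x≤y = +-monoˡ-≤ (+ c) x≤y
applyR-mono-≤ (dec c) x≤y = +-monoˡ-≤ (- + c) x≤y
applyR-mono-≤ dbl     x≤y = *-monoʳ-≤-nonNeg (+ 2) x≤y

SwapSafe : ℤ → ROp → ROp → Set
SwapSafe C o o' = ∀ r → r ≤ C → applyR o' (applyR o r) ≤ C →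
  applyR o' r ≤ C × applyR o (applyR o' r) ≤ applyR o' (applyR o r)

module _ (P : Program) where
  open Program P

  All-statesFrom-++⁺ : ∀ (ψ : State P → Set) u r₁ r₂ →
    (∀ s → All ψ (statesFrom P s r₁) → All ψ (statesFrom P s r₂)) →
    ∀ s → All ψ (statesFrom P s (u ++ r₁)) → All ψ (statesFrom P s (u ++ r₂))
  All-statesFrom-++⁺ ψ []      r₁ r₂ h s ψs        = h s ψs
  All-statesFrom-++⁺ ψ (t ∷ u) r₁ r₂ h s (ψs ∷ ψu) =
    ψs ∷ All-statesFrom-++⁺ ψ u r₁ r₂ h (step P t s) ψu

  module _ (C : ℤ) where

    Bounded : State P → Set
    Bounded s = res s ≤ C

    Bounded-statesFrom-head : ∀ {s} ts → All Bounded (statesFrom P s ts) → Bounded s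
    Bounded-statesFrom-head []      (b ∷ _) = b
    Bounded-statesFrom-head (_ ∷ _) (b ∷ _) = b

    Bounded-statesFrom-antitone : ∀ ts s s' → res s' ≤ res s →
      All Bounded (statesFrom P s ts) → All Bounded (statesFrom P s' ts)
    Bounded-statesFrom-antitone []       s s' r'≤r (b ∷ []) = ≤-trans r'≤r b ∷ []
    Bounded-statesFrom-antitone (t ∷ ts) s s' r'≤r (b ∷ bs) =
      ≤-trans r'≤r b ∷ Bounded-statesFrom-antitone ts (step P t s) (step P t s')
                         (applyR-mono-≤ (rop t) r'≤r) bs

    swap-Bounded : ∀ t t' → SwapSafe C (rop t) (rop t') → ∀ w s →
      All Bounded (statesFrom P s (t ∷ t' ∷ w)) → All Bounded (statesFrom P s (t' ∷ t ∷ w))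
    swap-Bounded t t' swap w s (b₀ ∷ _ ∷ bs)
      with swap (res s) b₀ (Bounded-statesFrom-head w bs)
    ... | middle , final≤ = b₀ ∷ middle ∷ Bounded-statesFrom-antitone w _ _ final≤ bs

    semiCommAt-SwapSafe : ∀ {o o'} t t' → rop t ≡ o → rop t' ≡ o' → SwapSafe C o o' →
      ∀ ℓ → SemiCommAt P ℓ (λ _ → ⊤) t t' Bounded
    semiCommAt-SwapSafe t t' t≡o t'≡o' swap ℓ θ _ _ _ _ w₁ w₂ _ _ =
      All-statesFrom-++⁺ Bounded θ _ _
        (All-statesFrom-++⁺ Bounded w₁ _ _
          (swap-Bounded t t' (subst₂ (SwapSafe C) (sym t≡o) (sym t'≡o') swap) w₂))
        (s₀ P)

module _ (C : ℤ) where
  open ≤-Reasoning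

  inc-dbl-SwapSafe : ∀ c → SwapSafe C (inc c) dbl
  inc-dbl-SwapSafe c r _ bound =
      ≤-trans (*-monoʳ-≤-nonNeg (+ 2) (i≤i+j r (+ c))) bound
    , (begin
        r * + 2 + + c        ≤⟨ i≤i+j _ (+ c) ⟩
        r * + 2 + + c + + c  ≡⟨ double-sum r (+ c) ⟩
        (r + + c) * + 2      ∎)
    where
    double-sum : ∀ x y → x * + 2 + y + y ≡ (x + y) * + 2
    double-sum = solve-∀

  inc-dec-SwapSafe : ∀ c d → SwapSafe C (inc c) (dec d)
  inc-dec-SwapSafe c d r r≤C _ =
    i≤j⇒i-k≤j (+ d) r≤C , ≤-reflexive (sub-add-comm r (+ c) (+ d))
    where
    sub-add-comm : ∀ x y z → x - z + y ≡ x + y - z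
    sub-add-comm = solve-∀

  dbl-dec-SwapSafe : ∀ d → SwapSafe C dbl (dec d)
  dbl-dec-SwapSafe d r r≤C _ =
      i≤j⇒i-k≤j (+ d) r≤C
    , (begin
        (r - + d) * + 2        ≤⟨ i≤i+j _ (+ d) ⟩
        (r - + d) * + 2 + + d  ≡⟨ double-diff r (+ d) ⟩
        r * + 2 - + d          ∎)
    where
    double-diff : ∀ x z → (x - z) * + 2 + z ≡ x * + 2 - z
    double-diff = solve-∀

proposition1 : (P : Program) (C : ℤ) (c₁ c₂ : ℕ) → 0 < c₁ → 0 < c₂ →
    (t₁ t₂ t₃ : Trans P) →
    OnlyAssignsR P t₁ (inc c₁) → OnlyAssignsR P t₂ dbl → OnlyAssignsR P t₃ (dec c₂) →
    ¬ CanDeschedule P t₁ t₂ → ¬ CanDeschedule P t₂ t₁ →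
    ¬ CanDeschedule P t₁ t₃ → ¬ CanDeschedule P t₃ t₁ →
    ¬ CanDeschedule P t₂ t₃ → ¬ CanDeschedule P t₃ t₂ →
    (ℓ : ProgPoint P) →
      SemiCommAt P ℓ (λ _ → ⊤) t₁ t₂ (λ s → res s ≤ C)
      × SemiCommAt P ℓ (λ _ → ⊤) t₁ t₃ (λ s → res s ≤ C)
      × SemiCommAt P ℓ (λ _ → ⊤) t₂ t₃ (λ s → res s ≤ C)
proposition1 P C c₁ c₂ _ _ t₁ t₂ t₃ (t₁≡inc , _) (t₂≡dbl , _) (t₃≡dec , _) _ _ _ _ _ _ ℓ =
    semiCommAt-SwapSafe P C t₁ t₂ t₁≡inc t₂≡dbl (inc-dbl-SwapSafe C c₁) ℓ
  , semiCommAt-SwapSafe P C t₁ t₃ t₁≡inc t₃≡dec (inc-dec-SwapSafe C c₁ c₂) ℓ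
  , semiCommAt-SwapSafe P C t₂ t₃ t₂≡dbl t₃≡dec (dbl-dec-SwapSafe C c₂) ℓ
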